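{- For every integer $n\geq 4$, $R(B_{n,n},S_n)>2n$.
   Context: For graphs $G_1,G_2$, $R(G_1,G_2)$ is the least integer $N$ such that every red/blue edge-coloring of $K_N$ contains a red copy of $G_1$ or a blue copy of $G_2$. $S_n$ denotes the star with $n$ edges ($n+1$ vertices). $B_{n,n}$ denotes the bistar on $2n$ vertices: two adjacent vertices each of degree $n$, and $2n-2$ further vertices of degree $1$. -}

module Defs where

open import Data.Nat using (ℕ; zero; suc; _+_; _*_; _≤_)
open import Data.Fin using (Fin; zero; suc; toℕ)
open import Data.Bool using (Bool; true; false)
open import Data.Product using (Σ; _×_; _,_; ∃)
open import Data.Sum using (_⊎_)
open import Relation.Binary.PropositionalEquality using (_≡_; _≢_)
open import Function.Definitions using (Injective)
open import Relation.Nullary using (¬_)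

record Graph (V : Set) : Set₁ where
  field
    Adj : V → V → Set
open Graph public

data Colour : Set where
  red blue : Colour

-- A red/blue edge-colouring of K_N: a symmetric colour assignment to pairs.
-- (The value on the diagonal is irrelevant.)
Colouring : ℕ → Set
Colouring N = Fin N → Fin N → Colour

SymmetricColouring : ∀ {N} → Colouring N → Set
SymmetricColouring {N} c = ∀ (x y : Fin N) → c x y ≡ c y x

HasMonoCopy : ∀ {N} {V : Set} → Colouring N → Colour → Graph V → Set
HasMonoCopy {N} {V} c col G =
  Σ (V → Fin N) λ f → Injective _≡_ _≡_ f ×
    (∀ u v → Adj G u v → c (f u) (f v) ≡ col)

Arrows : ∀ {V W : Set} → ℕ → Graph V → Graph W → Set
Arrows N G₁ G₂ = ∀ (c : Colouring N) → SymmetricColouring c →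
  HasMonoCopy c red G₁ ⊎ HasMonoCopy c blue G₂

-- R(G₁,G₂) > M  (R is the least N with K_N → (G₁,G₂)):
-- no N ≤ M has the arrowing property.
RamseyGreaterThan : ∀ {V W : Set} → Graph V → Graph W → ℕ → Set
RamseyGreaterThan G₁ G₂ M = ∀ N → N ≤ M → ¬ Arrows N G₁ G₂

Star : (n : ℕ) → Graph (Fin (suc n))
Adj (Star n) u v = (u ≡ zero × v ≢ zero) ⊎ (v ≡ zero × u ≢ zero)

-- The bistar B_{n,n} (n ≥ 1) on 2n vertices Bool × Fin n:
-- (vertex (b , i) is a centre iff toℕ i ≡ 0)
-- centres (false , zero) and (true , zero) are adjacent;
-- each leaf (b , suc i) is adjacent to its centre (b , zero).
-- Each centre has degree (n-1)+1 = n.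
Bistar : (n : ℕ) → Graph (Bool × Fin n)
Adj (Bistar n) (b , i) (b' , j) =
  (toℕ i ≡ 0 × toℕ j ≡ 0 × b ≢ b')
  ⊎ (b ≡ b' × toℕ i ≡ 0 × toℕ j ≢ 0)
  ⊎ (b ≡ b' × toℕ j ≡ 0 × toℕ i ≢ 0)

-- Since the arrowing property K_N → (G₁,G₂) is inherited by larger N, it
-- suffices to colour K_{2n} with neither a red B_{n,n} nor a blue S_n.
--
-- The vertex set of K_{2n} is identified with two parts Bool × Fin n.
-- Inside part b the red graph is a graph H_b on Fin n; between the parts,
-- (a,i) and (b,j) are red iff i ≢ j, so the blue cross edges form a perfect
-- matching.  The two "scaffold" graphs H_false, H_true are edge-disjoint,
-- have no isolated vertices and no dominating edge (for every edge ij some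
-- third vertex is adjacent to neither i nor j).  Then:
--   * every vertex has at most n-1 blue neighbours (no blue S_n), since it
--     loses a blue neighbour inside its part to an H-neighbour;
--   * a red B_{n,n} spans all 2n vertices, so its central edge would be a
--     dominating red edge, but no red edge dominates.
-- For n ≥ 4 the scaffold is: H_false joins i, j with |i - j| = 2, and
-- H_true joins i, j with |i - j| = 1 except for the pair {1, 2}.
module Submission where

open import Defs
open import Data.Nat as ℕ using (ℕ; zero; suc; _+_; _*_; _≤_; _<_; z≤n; s≤s)
open import Data.Nat.Properties using (m≢1+n+m; ≤-trans; 1+n≰n; n≤1+n)
open import Data.Fin as Fin using (Fin; toℕ; fromℕ<; inject≤; punchOut)
open import Data.Fin.Properties
  using (toℕ-fromℕ<; inject≤-injective; injective⇒≤; punchOut-injective; toℕ<n; any?; *↔×; 2↔Bool)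
open import Data.Bool using (Bool; true; false)
open import Data.Bool.Properties using (¬-not) renaming (_≟_ to _≟ᵇ_)
open import Data.Product using (Σ; _×_; _,_; proj₁; proj₂; ∃; ∃-syntax)
open import Data.Product.Function.NonDependent.Propositional using (_×-↔_)
open import Data.Sum as Sum using (_⊎_; inj₁; inj₂; [_,_])
open import Function using (_∘_; _↔_; Inverse; Injection)
open import Function.Definitions using (Injective)
open import Function.Properties.Inverse using (↔-trans; ↔-refl; ↔⇒↣)
open import Relation.Nullary using (¬_; Dec; yes; no; contradiction)
open import Relation.Nullary.Decidable using (_×-dec_; _⊎-dec_; ¬?)
open import Relation.Binary.PropositionalEquality
  using (_≡_; _≢_; refl; sym; trans; cong; subst)

-- An injective self-map of a finite set is surjective: a missed value
-- would let punchOut squeeze Fin (suc k) injectively into Fin k.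
injective⇒surjective : ∀ {m} (g : Fin m → Fin m) → Injective _≡_ _≡_ g →
                       ∀ z → ∃[ x ] g x ≡ z
injective⇒surjective {suc k} g g-inj z with any? (λ x → g x Fin.≟ z)
... | yes hit = hit
... | no miss = contradiction (injective⇒≤ squeezed-injective) 1+n≰n
  where
  avoids : ∀ x → z ≢ g x
  avoids x z≡gx = miss (x , sym z≡gx)

  squeezed : Fin (suc k) → Fin k
  squeezed x = punchOut (avoids x)

  squeezed-injective : Injective _≡_ _≡_ squeezed
  squeezed-injective e = g-inj (punchOut-injective (avoids _) (avoids _) e)

twoParts : ∀ {n} → Fin (2 * n) ↔ (Bool × Fin n)
twoParts = ↔-trans *↔× (2↔Bool ×-↔ ↔-refl)

twoParts-injective : ∀ {n} → Injective _≡_ _≡_ (Inverse.to (twoParts {n}))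
twoParts-injective = Injection.injective (↔⇒↣ twoParts)

copy-extend : ∀ {M N} {V : Set} {G : Graph V} {col : Colour}
              (c : Colouring N) (ι : Fin M → Fin N) → Injective _≡_ _≡_ ι →
              HasMonoCopy (λ x y → c (ι x) (ι y)) col G → HasMonoCopy c col G
copy-extend c ι ι-inj (f , f-inj , edges) = ι ∘ f , f-inj ∘ ι-inj , edges

arrows-mono : ∀ {V W : Set} {G₁ : Graph V} {G₂ : Graph W} {M N} →
              M ≤ N → Arrows M G₁ G₂ → Arrows N G₁ G₂
arrows-mono {M = M} M≤N arrows c c-sym =
  Sum.map (copy-extend c ι ι-injective) (copy-extend c ι ι-injective)
          (arrows (λ x y → c (ι x) (ι y)) (λ x y → c-sym (ι x) (ι y)))
  where
  ι : Fin M → Fin _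
  ι x = inject≤ x M≤N

  ι-injective : Injective _≡_ _≡_ ι
  ι-injective = inject≤-injective M≤N M≤N _ _

ClosedNbr : ∀ {N} → Colouring N → Colour → Fin N → Fin N → Set
ClosedNbr c col p q = q ≡ p ⊎ c p q ≡ col

-- Every closed col-neighbourhood admits a labelling by Fin n that is
-- injective on it, i.e. every vertex has at most n-1 col-neighbours.
ClosedNbrsEmbedIn : ∀ {N} → Colouring N → Colour → ℕ → Set
ClosedNbrsEmbedIn {N} c col n = ∀ p → Σ (Fin N → Fin n) λ label → ∀ {q q'} →
  ClosedNbr c col p q → ClosedNbr c col p q' → label q ≡ label q' → q ≡ q'

-- A col-coloured S_n would put n+1 distinct vertices into the closed
-- neighbourhood of its centre.
small-nbrs⇒no-star : ∀ {N n} (c : Colouring N) (col : Colour) →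
  ClosedNbrsEmbedIn c col n → ¬ HasMonoCopy c col (Star n)
small-nbrs⇒no-star c col small (f , f-inj , edges)
  with label , label-inj ← small (f Fin.zero) =
    1+n≰n (injective⇒≤ {f = label ∘ f} λ e → f-inj (label-inj (in-nbr _) (in-nbr _) e))
  where
  in-nbr : ∀ k → ClosedNbr c col (f Fin.zero) (f k)
  in-nbr Fin.zero = inj₁ refl
  in-nbr (Fin.suc k) = inj₂ (edges Fin.zero (Fin.suc k) (inj₁ (refl , λ ())))

DominatedBy : ∀ {N} → Colouring N → Colour → Fin N → Fin N → Fin N → Set
DominatedBy c col u v z = z ≡ u ⊎ z ≡ v ⊎ c u z ≡ col ⊎ c v z ≡ col

DominatingEdge : ∀ {N} → Colouring N → Colour → Set
DominatingEdge {N} c col = Σ (Fin N) λ u → Σ (Fin N) λ v →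
  c u v ≡ col × (∀ z → DominatedBy c col u v z)

-- A col-coloured B_{n,n} in K_{2n} uses every vertex, so its central edge
-- dominates.
spanning-bistar⇒dominating-edge : ∀ {k} (c : Colouring (2 * suc k)) {col} →
  HasMonoCopy c col (Bistar (suc k)) → DominatingEdge c col
spanning-bistar⇒dominating-edge {k} c {col} (f , f-inj , edges) =
  centre false , centre true , edges _ _ (inj₁ (refl , refl , λ ())) , dominated
  where
  open Inverse twoParts using (to)

  centre : Bool → Fin (2 * suc k)
  centre b = f (b , Fin.zero)

  leaf : ∀ b j → c (centre b) (f (b , Fin.suc j)) ≡ col
  leaf b j = edges _ _ (inj₂ (inj₁ (refl , refl , λ ())))

  covered : ∀ w → DominatedBy c col (centre false) (centre true) (f w)
  covered (false , Fin.zero) = inj₁ refl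
  covered (true , Fin.zero) = inj₂ (inj₁ refl)
  covered (false , Fin.suc j) = inj₂ (inj₂ (inj₁ (leaf false j)))
  covered (true , Fin.suc j) = inj₂ (inj₂ (inj₂ (leaf true j)))

  dominated : ∀ z → DominatedBy c col (centre false) (centre true) z
  dominated z with injective⇒surjective (f ∘ to) (twoParts-injective ∘ f-inj) z
  ... | x , refl = covered (to x)

colourOf : ∀ {P : Set} → Dec P → Colour
colourOf (yes _) = red
colourOf (no _) = blue

colourOf-red : ∀ {P : Set} (d : Dec P) → colourOf d ≡ red → P
colourOf-red (yes p) _ = p

colourOf-blue : ∀ {P : Set} (d : Dec P) → colourOf d ≡ blue → ¬ P
colourOf-blue (no ¬p) _ = ¬p

colourOf-cong : ∀ {P Q : Set} → (P → Q) → (Q → P) →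
                (d : Dec P) (e : Dec Q) → colourOf d ≡ colourOf e
colourOf-cong P⇒Q Q⇒P (yes _) (yes _) = refl
colourOf-cong P⇒Q Q⇒P (yes p) (no ¬q) = contradiction (P⇒Q p) ¬q
colourOf-cong P⇒Q Q⇒P (no ¬p) (yes q) = contradiction (Q⇒P q) ¬p
colourOf-cong P⇒Q Q⇒P (no _) (no _) = refl

record Scaffold (n : ℕ) : Set₁ where
  field
    H : Bool → Fin n → Fin n → Set
    H? : ∀ b i j → Dec (H b i j)
    H-sym : ∀ b {i j} → H b i j → H b j i
    H-irrefl : ∀ b {i} → ¬ H b i i
    H-disjoint : ∀ {i j} → H false i j → ¬ H true i j
    neighbour : ∀ b i → ∃[ j ] H b i j
    non-dominating : ∀ b {i j} → H b i j →
                     ∃[ x ] x ≢ i × x ≢ j × ¬ H b i x × ¬ H b j x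

module Construction {n : ℕ} (S : Scaffold n) where
  open Scaffold S

  H-exclusive : ∀ {a b} → a ≢ b → ∀ {i j} → H a i j → ¬ H b i j
  H-exclusive {false} {false} a≢b = contradiction refl a≢b
  H-exclusive {false} {true} _ = H-disjoint
  H-exclusive {true} {false} _ h h' = H-disjoint h' h
  H-exclusive {true} {true} a≢b = contradiction refl a≢b

  Vertex : Set
  Vertex = Bool × Fin n

  Red : Vertex → Vertex → Set
  Red (a , i) (b , j) = (a ≡ b × H a i j) ⊎ (a ≢ b × i ≢ j)

  Red? : ∀ p q → Dec (Red p q)
  Red? (a , i) (b , j) =
    ((a ≟ᵇ b) ×-dec H? a i j) ⊎-dec (¬? (a ≟ᵇ b) ×-dec ¬? (i Fin.≟ j))

  Red-sym : ∀ {p q} → Red p q → Red q p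
  Red-sym {a , _} (inj₁ (refl , h)) = inj₁ (refl , H-sym a h)
  Red-sym (inj₂ (a≢b , i≢j)) = inj₂ (a≢b ∘ sym , i≢j ∘ sym)

  red-edge-not-dominating : ∀ {u v} → Red u v →
                            ∃[ z ] z ≢ u × z ≢ v × ¬ Red u z × ¬ Red v z
  red-edge-not-dominating {a , i} {.a , j} (inj₁ (refl , h))
    with x , x≢i , x≢j , ¬hix , ¬hjx ← non-dominating a h =
      (a , x) , x≢i ∘ cong proj₂ , x≢j ∘ cong proj₂ , same-part ¬hix , same-part ¬hjx
    where
    same-part : ∀ {k} → ¬ H a k x → ¬ Red (a , k) (a , x)
    same-part ¬h (inj₁ (_ , h')) = ¬h h'
    same-part ¬h (inj₂ (a≢a , _)) = a≢a refl
  red-edge-not-dominating {a , i} {b , j} (inj₂ (a≢b , i≢j)) with H? b j i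
  -- (b,i) is matched to (a,i) and not an H_b-neighbour of j.
  ... | no ¬hji = (b , i) , a≢b ∘ sym ∘ cong proj₁ , i≢j ∘ cong proj₂ ,
    (λ { (inj₁ (a≡b , _)) → a≢b a≡b ; (inj₂ (_ , i≢i)) → i≢i refl }) ,
    (λ { (inj₁ (_ , hji)) → ¬hji hji ; (inj₂ (b≢b , _)) → b≢b refl })
  -- Otherwise ij is an edge of H_b, hence not of H_a, and (a,j) works.
  ... | yes hji = (a , j) , i≢j ∘ sym ∘ cong proj₂ , a≢b ∘ cong proj₁ ,
    (λ { (inj₁ (_ , hij)) → H-exclusive (a≢b ∘ sym) (H-sym b hji) hij
       ; (inj₂ (a≢a , _)) → a≢a refl }) ,
    (λ { (inj₁ (b≡a , _)) → a≢b (sym b≡a) ; (inj₂ (_ , j≢j)) → j≢j refl })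

  ClosedBlue : Vertex → Vertex → Set
  ClosedBlue (a , i) (b , j) = (a ≡ b × ¬ H a i j) ⊎ (a ≢ b × i ≡ j)

  closedBlue : ∀ {p q} → q ≡ p ⊎ ¬ Red p q → ClosedBlue p q
  closedBlue {a , _} (inj₁ refl) = inj₁ (refl , H-irrefl a)
  closedBlue {a , i} {b , j} (inj₂ ¬red) with a ≟ᵇ b | i Fin.≟ j
  ... | yes refl | _ = inj₁ (refl , λ h → ¬red (inj₁ (refl , h)))
  ... | no a≢b | yes i≡j = inj₂ (a≢b , i≡j)
  ... | no a≢b | no i≢j = contradiction (inj₂ (a≢b , i≢j)) ¬red

  -- Labels for the closed blue neighbourhood of p: a vertex in p's part keeps
  -- its index; the matched vertex takes the index of an H-neighbour of p.
  label : Vertex → Vertex → Fin n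
  label (a , i) (b , j) with a ≟ᵇ b
  ... | yes _ = j
  ... | no _ = proj₁ (neighbour a i)

  label-same : ∀ a i j → label (a , i) (a , j) ≡ j
  label-same a i j with a ≟ᵇ a
  ... | yes _ = refl
  ... | no a≢a = contradiction refl a≢a

  label-other : ∀ a i b j → a ≢ b → label (a , i) (b , j) ≡ proj₁ (neighbour a i)
  label-other a i b j a≢b with a ≟ᵇ b
  ... | yes a≡b = contradiction a≡b a≢b
  ... | no _ = refl

  label-injective : ∀ {a i b j b' j'} →
    ClosedBlue (a , i) (b , j) → ClosedBlue (a , i) (b' , j') →
    label (a , i) (b , j) ≡ label (a , i) (b' , j') → (b , j) ≡ (b' , j')
  label-injective {a} {i} {j = j} {j' = j'} (inj₁ (refl , _)) (inj₁ (refl , _)) e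
    rewrite label-same a i j | label-same a i j' = cong (a ,_) e
  label-injective {a} {i} {j = j} {b'} (inj₁ (refl , ¬h)) (inj₂ (a≢b' , refl)) e
    rewrite label-same a i j | label-other a i b' i a≢b' =
      contradiction (subst (H a i) (sym e) (proj₂ (neighbour a i))) ¬h
  label-injective {a} {i} {b = b} {j' = j'} (inj₂ (a≢b , refl)) (inj₁ (refl , ¬h)) e
    rewrite label-same a i j' | label-other a i b i a≢b =
      contradiction (subst (H a i) e (proj₂ (neighbour a i))) ¬h
  label-injective (inj₂ (a≢b , refl)) (inj₂ (a≢b' , refl)) _ =
    cong (_, _) (trans (¬-not (a≢b ∘ sym)) (sym (¬-not (a≢b' ∘ sym))))

  open Inverse (twoParts {n}) using (to; from; strictlyInverseˡ)

  colouring : Colouring (2 * n)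
  colouring x y = colourOf (Red? (to x) (to y))

  colouring-sym : SymmetricColouring colouring
  colouring-sym x y = colourOf-cong Red-sym Red-sym _ _

  colouring-red : ∀ {x y} → colouring x y ≡ red → Red (to x) (to y)
  colouring-red = colourOf-red (Red? _ _)

  colouring-blue : ∀ {x y} → colouring x y ≡ blue → ¬ Red (to x) (to y)
  colouring-blue = colourOf-blue (Red? _ _)

  closed-blue-nbrs-small : ClosedNbrsEmbedIn colouring blue n
  closed-blue-nbrs-small p = (λ q → label (to p) (to q)) ,
    λ q∈ q'∈ e → twoParts-injective (label-injective (shape q∈) (shape q'∈) e)
    where
    shape : ∀ {q} → ClosedNbr colouring blue p q → ClosedBlue (to p) (to q)
    shape (inj₁ refl) = closedBlue (inj₁ refl)
    shape (inj₂ pq-blue) = closedBlue (inj₂ (colouring-blue pq-blue))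

  no-blue-star : ¬ HasMonoCopy colouring blue (Star n)
  no-blue-star = small-nbrs⇒no-star colouring blue closed-blue-nbrs-small

  no-dominating-red-edge : ¬ DominatingEdge colouring red
  no-dominating-red-edge (u , v , uv-red , dominated)
    with z , z≢u , z≢v , ¬uz , ¬vz ← red-edge-not-dominating (colouring-red uv-red)
    with from z | strictlyInverseˡ z | dominated (from z)
  ... | _ | refl | inj₁ refl = z≢u refl
  ... | _ | refl | inj₂ (inj₁ refl) = z≢v refl
  ... | _ | refl | inj₂ (inj₂ (inj₁ uz)) = ¬uz (colouring-red uz)
  ... | _ | refl | inj₂ (inj₂ (inj₂ vz)) = ¬vz (colouring-red vz)

-- The concrete scaffold on Fin n, n ≥ 4, is defined on indices in ℕ and
-- transported to Fin n through toℕ.  Symmetric closure of a relation: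
SymClosure : (ℕ → ℕ → Set) → ℕ → ℕ → Set
SymClosure R m k = R m k ⊎ R k m

swap : ∀ {R m k} → SymClosure R m k → SymClosure R k m
swap (inj₁ r) = inj₂ r
swap (inj₂ r) = inj₁ r

DistanceTwo SplitStep : ℕ → ℕ → Set
DistanceTwo m k = 2 + m ≡ k
SplitStep m k = suc m ≡ k × m ≢ 1

Hℕ : Bool → ℕ → ℕ → Set
Hℕ false = SymClosure DistanceTwo
Hℕ true = SymClosure SplitStep

Hℕ? : ∀ b m k → Dec (Hℕ b m k)
Hℕ? false m k = (2 + m ℕ.≟ k) ⊎-dec (2 + k ℕ.≟ m)
Hℕ? true m k = ((suc m ℕ.≟ k) ×-dec ¬? (m ℕ.≟ 1)) ⊎-dec ((suc k ℕ.≟ m) ×-dec ¬? (k ℕ.≟ 1))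

Hℕ-sym : ∀ b {m k} → Hℕ b m k → Hℕ b k m
Hℕ-sym false = swap {DistanceTwo}
Hℕ-sym true = swap {SplitStep}

shift-absurd : ∀ d {m} → suc d + m ≢ m
shift-absurd d {m} e = m≢1+n+m m (sym e)

Hℕ-irrefl : ∀ b {m} → ¬ Hℕ b m m
Hℕ-irrefl false (inj₁ e) = shift-absurd 1 e
Hℕ-irrefl false (inj₂ e) = shift-absurd 1 e
Hℕ-irrefl true (inj₁ (e , _)) = shift-absurd 0 e
Hℕ-irrefl true (inj₂ (e , _)) = shift-absurd 0 e

Hℕ-disjoint : ∀ {m k} → Hℕ false m k → ¬ Hℕ true m k
Hℕ-disjoint (inj₁ refl) (inj₁ (e , _)) = shift-absurd 0 (sym e)
Hℕ-disjoint (inj₁ refl) (inj₂ (e , _)) = shift-absurd 2 e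
Hℕ-disjoint (inj₂ refl) (inj₁ (e , _)) = shift-absurd 2 e
Hℕ-disjoint (inj₂ refl) (inj₂ (e , _)) = shift-absurd 0 (sym e)

-- Witnesses below n, which exist once n ≥ 4.
module _ {n : ℕ} (4≤n : 4 ≤ n) where
  private
    3<n : 3 < n
    3<n = 4≤n

    2<n : 2 < n
    2<n = ≤-trans (s≤s (s≤s (s≤s z≤n))) 4≤n

  Hℕ-neighbour : ∀ b m → m < n → ∃[ x ] x < n × Hℕ b m x
  Hℕ-neighbour false zero _ = 2 , 2<n , inj₁ refl
  Hℕ-neighbour false (suc zero) _ = 3 , 3<n , inj₁ refl
  Hℕ-neighbour false (suc (suc m)) m+2<n =
    m , ≤-trans (n≤1+n _) (≤-trans (n≤1+n _) m+2<n) , inj₂ refl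
  Hℕ-neighbour true zero _ = 1 , ≤-trans (s≤s (s≤s z≤n)) 2<n , inj₁ (refl , λ ())
  Hℕ-neighbour true (suc zero) _ = 0 , ≤-trans (s≤s z≤n) 2<n , inj₂ (refl , λ ())
  Hℕ-neighbour true (suc (suc zero)) _ = 3 , 3<n , inj₁ (refl , λ ())
  Hℕ-neighbour true (suc (suc (suc m))) m+3<n =
    suc (suc m) , ≤-trans (n≤1+n _) m+3<n , inj₂ (refl , λ ())

  Undominated : Bool → ℕ → ℕ → ℕ → Set
  Undominated b m k x = x < n × x ≢ m × x ≢ k × ¬ Hℕ b m x × ¬ Hℕ b k x

  undominated-swap : ∀ {b m k} → ∃ (Undominated b m k) → ∃ (Undominated b k m)
  undominated-swap (x , x<n , x≢m , x≢k , ¬mx , ¬kx) = x , x<n , x≢k , x≢m , ¬kx , ¬mx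

  -- For m, m+2 take the midpoint m+1.
  distanceTwo-undominated : ∀ m → 2 + m < n → ∃ (Undominated false m (2 + m))
  distanceTwo-undominated m m+2<n =
    suc m , ≤-trans (n≤1+n _) m+2<n , shift-absurd 0 , shift-absurd 0 ∘ sym ,
    (λ { (inj₁ e) → shift-absurd 0 e ; (inj₂ e) → shift-absurd 2 e }) ,
    (λ { (inj₁ e) → shift-absurd 2 e ; (inj₂ e) → shift-absurd 0 e })

  -- For 0,1 take 2 (as 1,2 is not an edge); for m,m+1 with m ≥ 2 take 0.
  splitStep-undominated : ∀ m → suc m < n → m ≢ 1 → ∃ (Undominated true m (suc m))
  splitStep-undominated zero _ _ =
    2 , 2<n , (λ ()) , (λ ()) ,
    (λ { (inj₁ (() , _)) ; (inj₂ (() , _)) }) ,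
    (λ { (inj₁ (_ , 1≢1)) → 1≢1 refl ; (inj₂ (() , _)) })
  splitStep-undominated (suc zero) _ 1≢1 = contradiction refl 1≢1
  splitStep-undominated (suc (suc m)) m+3<n _ =
    0 , ≤-trans (s≤s z≤n) m+3<n , (λ ()) , (λ ()) ,
    (λ { (inj₁ (() , _)) ; (inj₂ (() , _)) }) ,
    (λ { (inj₁ (() , _)) ; (inj₂ (() , _)) })

  Hℕ-undominated : ∀ b m k → m < n → k < n → Hℕ b m k → ∃ (Undominated b m k)
  Hℕ-undominated false m _ _ k<n (inj₁ refl) = distanceTwo-undominated m k<n
  Hℕ-undominated false _ k m<n _ (inj₂ refl) =
    undominated-swap {false} (distanceTwo-undominated k m<n)
  Hℕ-undominated true m _ _ k<n (inj₁ (refl , m≢1)) = splitStep-undominated m k<n m≢1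
  Hℕ-undominated true _ k m<n _ (inj₂ (refl , k≢1)) =
    undominated-swap {true} (splitStep-undominated k m<n k≢1)

toFin-witness : ∀ {n} {P : ℕ → Set} → (∃[ x ] x < n × P x) → ∃[ y ] P (toℕ {n} y)
toFin-witness {P = P} (x , x<n , px) = fromℕ< x<n , subst P (sym (toℕ-fromℕ< x<n)) px

scaffold : ∀ n → 4 ≤ n → Scaffold n
scaffold n 4≤n = record
  { H = λ b i j → Hℕ b (toℕ i) (toℕ j)
  ; H? = λ b i j → Hℕ? b (toℕ i) (toℕ j)
  ; H-sym = λ b → Hℕ-sym b
  ; H-irrefl = λ b → Hℕ-irrefl b
  ; H-disjoint = λ h → Hℕ-disjoint h
  ; neighbour = λ b i → toFin-witness (Hℕ-neighbour 4≤n b (toℕ i) (toℕ<n i))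
  ; non-dominating = non-dominating
  }
  where
  non-dominating : ∀ b {i j : Fin n} → Hℕ b (toℕ i) (toℕ j) →
    ∃[ x ] x ≢ i × x ≢ j × ¬ Hℕ b (toℕ i) (toℕ x) × ¬ Hℕ b (toℕ j) (toℕ x)
  non-dominating b {i} {j} h
    with x , x≢i , x≢j , ¬ix , ¬jx ← toFin-witness (Hℕ-undominated 4≤n b _ _ (toℕ<n i) (toℕ<n j) h)
    = x , x≢i ∘ cong toℕ , x≢j ∘ cong toℕ , ¬ix , ¬jx

corollary4 : ∀ (n : ℕ) → 4 ≤ n → RamseyGreaterThan (Bistar n) (Star n) (2 * n)
corollary4 zero ()
corollary4 n@(suc _) 4≤n N N≤2n arrows =
  [ no-dominating-red-edge ∘ spanning-bistar⇒dominating-edge colouring , no-blue-star ]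
    (arrows-mono N≤2n arrows colouring colouring-sym)
  where open Construction (scaffold n 4≤n)
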